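{- Let $C$ be a reachable command, $(s,h)\in\mathcal{S}$, $\Gamma$ a resource context, $\rho=(O,L,D)$ a resource configuration, $Q,R$ assertions and $A,X\subseteq\mathbf{Var}$. Suppose $r\in O$, $\Gamma'=\Gamma,r(X):R$ is a resource context, and $FV(Q)\subseteq A$. If $\mathit{Safe}_n(C,s,h,\rho\setminus\{r\},\Gamma,Q\ast R,A\cup X)$ holds, then $\mathit{Safe}_n(\mathsf{within}\ r\ \mathsf{do}\ C,s,h,\rho,\Gamma',Q,A)$ holds.
   Context: Stores $s:\mathbf{Var}\to\mathbf{Val}$; finite partial heaps; $\mathcal{S}$ pairs $(s,h)$; separation-logic assertions with standard satisfaction and free variables $FV$; $h\bot g$ disjoint domains, $h\uplus g$ union. A resource context is a list $r_1(X_1):R_1,\dots,r_n(X_n):R_n$ (distinct resource names, $X_i\subseteq\mathbf{Var}$, precise $R_i$ with $FV(R_i)\subseteq X_i$); $\Gamma,r(X):R$ is its extension by a new entry; $PV(r_i)=X_i$, $\Gamma(r_i)=R_i$, $\circledast_{r\in D}\Gamma(r)$ separating conjunction over $D$ ($\texttt{emp}$ if empty). Resource configuration: triple $(O,L,D)$ of pairwise disjoint sets of resource names; $r\in\rho$ iff $r\in O\cup L\cup D$; $\rho\setminus\{r\}$ componentwise removal. Commands: $\mathsf{skip}$, basic commands $x:=e$, $x:=[e]$, $[e]:=e'$, $x:=\mathsf{cons}(\dots)$, $\mathsf{dispose}(e)$ (standard semantics $[c](s,h)$, pair or $\mathsf{abort}$), $C_1;C_2$, $\mathsf{if}$, $\mathsf{while}$,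 $\mathsf{resource}\ r\ \mathsf{in}\ C$, $\mathsf{with}\ r\ \mathsf{when}\ B\ \mathsf{do}\ C$, $C_1\|C_2$ (unextended), and $\mathsf{within}\ r\ \mathsf{do}\ C$. $Locked(C_1;C_2)=Locked(C_1)$, $Locked(C_1\|C_2)=Locked(C_1)\cup Locked(C_2)$, $Locked(\mathsf{resource}\ r\ \mathsf{in}\ C)=Locked(C)\setminus\{r\}$, $Locked(\mathsf{within}\ r\ \mathsf{do}\ C)=Locked(C)\cup\{r\}$, else $\emptyset$. Program transitions $\to_p$: (S1) $\mathsf{skip};C_2\to C_2$; (S2) $C_1;C_2$ steps via $C_1$; (LP) while unfolds to $\mathsf{if}\ B\ \mathsf{then}\ (C;\mathsf{while}\ B\ \mathsf{do}\ C)\ \mathsf{else}\ \mathsf{skip}$; (IF1/IF2) by $s(B)$; (P1/P2) a parallel component steps; (P3) $\mathsf{skip}\|\mathsf{skip}\to\mathsf{skip}$; (R0) $\mathsf{resource}\ r\ \mathsf{in}\ \mathsf{skip}\to\mathsf{skip}$ if $r\notin\rho$; (R1) if $r\notin\rho=(O,L,D)$, $r\in Locked(C)$, $C,(s,h,(O\cup\{r\},L,D))\to_pC',(s',h',\rho')$ then $\mathsf{resource}\ r\ \mathsf{in}\ C,(s,h,\rho)\to_p\mathsf{resource}\ r\ \mathsf{in}\ C',(s',h',\rho'\setminus\{r\})$; (R2) same with $r\notin Locked(C)$ and $(O,L,D\cup\{r\})$; (W0) $\mathsf{with}\ r\ \mathsf{when}\ B\ \mathsf{do}\ C,(s,h,(O,L,D\cup\{r\}))\to_p\mathsf{within}\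 r\ \mathsf{do}\ C,(s,h,(O\cup\{r\},L,D))$ if $s(B)=\texttt{true}$; (W1) if $r\in O$ and $C,(s,h,(O\setminus\{r\},L,D))\to_pC',(s',h',(O',L',D'))$ then $\mathsf{within}\ r\ \mathsf{do}\ C,(s,h,(O,L,D))\to_p\mathsf{within}\ r\ \mathsf{do}\ C',(s',h',(O'\cup\{r\},L',D'))$; (W2) $\mathsf{within}\ r\ \mathsf{do}\ \mathsf{skip},(s,h,(O\cup\{r\},L,D))\to_p\mathsf{skip},(s,h,(O,L,D\cup\{r\}))$; (BCT) $c,(s,h,\rho)\to_p\mathsf{skip},(s',h',\rho)$ if $[c](s,h)=(s',h')$. Abort: (RA) $\mathsf{resource}\ r$ with $r\in\rho$; (WA) $\mathsf{with}\ r$ with $r\notin\rho$; (RA1)/(RA2) body aborts under the configurations of (R1)/(R2); (BCA) $[c](s,h)=\mathsf{abort}$; (SA) first component of $;$ aborts; (WA1) body of $\mathsf{within}\ r$ aborts under $\rho\setminus\{r\}$; (WA2) $\mathsf{within}\ r$ with $r\notin O$; (PA1/PA2) a component of $\|$ aborts. A command is reachable if for some unextended $C_0$ there are states $\sigma,\sigma'$ and $k$ with $C_0,\sigma\to_p^kC',\sigma'$ and $C_0,\sigma\not\to_p^j\mathsf{abort}$ for $j\le k$. Environment: $(s,h,(O,L,D))\stackrel{A}{\leftrightsquigarrow}(s',h,(O,L',D'))$ iff $s(x)=s'(x)$ for $x\in A$ and $L'\cup D'=L\cup D$; with $A'=A\cup\bigcup_{r\in Locked(C)}PV(r)$, if $(s,h,\rho)\stackrel{A'}{\leftrightsquigarrow}(s',h,\rho')$,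 $\rho=(O,L,D)$, $\rho'=(O,L',D')$, $s,h_G\models\circledast_{r\in D}\Gamma(r)$, $s',h'_G\models\circledast_{r\in D'}\Gamma(r)$, then $C,(s,h\uplus h_G,\rho)\xrightarrow{A,\Gamma}_eC,(s',h\uplus h'_G,\rho')$; $\xrightarrow{A,\Gamma}=\to_p\cup\xrightarrow{A,\Gamma}_e$. $chng(C)$: variables $x$ such that the next transition of $C$ can execute $x:=e$, $x:=[e]$ or $x:=\mathsf{cons}(\dots)$. Safety: $\mathit{Safe}_0$ always holds; $\mathit{Safe}_{n+1}(C,s,h,\rho,\Gamma,Q,A)$, $\rho=(O,L,D)$, iff (i) $C=\mathsf{skip}\Rightarrow s,h\models Q$; (ii) $C,(s,h,\rho)\not\to_p\mathsf{abort}$; (iii) $chng(C)\cap\bigcup_{r\in L\cup D}PV(r)=\emptyset$; (iv) for every $h_G\bot h$ with $s,h_G\models\circledast_{r\in D}\Gamma(r)$ and every $C,(s,h\uplus h_G,\rho)\xrightarrow{A,\Gamma}C',(s',\hat h,\rho')$, $\rho'=(O',L',D')$, there exist $h',h'_G$ with $\hat h=h'\uplus h'_G$, $s',h'_G\models\circledast_{r\in D'}\Gamma(r)$ and $\mathit{Safe}_n(C',s',h',\rho',\Gamma,Q,A)$. -}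

module Defs where

open import Data.Nat using (ℕ; zero; suc; _+_; _∸_; _≤_; _<_; _≡ᵇ_; _≤ᵇ_)
open import Data.Nat.Properties using (_≟_)
open import Data.Bool using (Bool; true; false; not; _∧_)
open import Data.Maybe using (Maybe; just; nothing)
open import Data.List using (List; []; _∷_; _++_; filter; length; lookup)
open import Data.List.Membership.Propositional using (_∈_; _∉_)
open import Data.Fin using (Fin; toℕ)
open import Data.Product using (Σ; _×_; _,_)
open import Data.Sum using (_⊎_)
open import Data.Empty using (⊥)
open import Data.Unit using (⊤)
open import Relation.Nullary using (¬_; yes; no; ¬?)

open import Relation.Binary.PropositionalEquality using (_≡_; _≢_)

Var : Set
Var = ℕ

Val : Set
Val = ℕ

Loc : Set
Loc = ℕ

ResName : Set
ResName = ℕ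

Store : Set
Store = Var → Val

VarSet : Set₁
VarSet = Var → Set

_∪V_ : VarSet → VarSet → VarSet
(A ∪V B) x = A x ⊎ B x

_[_↦_] : Store → Var → Val → Store
(s [ x ↦ v ]) y with y ≟ x
... | yes _ = v
... | no  _ = s y

record Heap : Set where
  field
    at     : Loc → Maybe Val
    bound  : ℕ
    finite : ∀ l → bound ≤ l → at l ≡ nothing
open Heap public

_≗h_ : Heap → Heap → Set
h₁ ≗h h₂ = ∀ l → at h₁ l ≡ at h₂ l

_⊑_ : Heap → Heap → Set
h₁ ⊑ h = ∀ l v → at h₁ l ≡ just v → at h l ≡ just v

-- Join h₁ h₂ h :  h₁ ⊥ h₂  and  h = h₁ ⊎ h₂
Join : Heap → Heap → Heap → Set
Join h₁ h₂ h = ∀ l → (at h₁ l ≡ nothing × at h l ≡ at h₂ l)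
                   ⊎ (at h₂ l ≡ nothing × at h l ≡ at h₁ l)

data Exp : Set where
  var  : Var → Exp
  lit  : Val → Exp
  _⊕_  : Exp → Exp → Exp
  _⊖_  : Exp → Exp → Exp

data BExp : Set where
  tt ff : BExp
  _==_  : Exp → Exp → BExp
  _<=_  : Exp → Exp → BExp
  bnot  : BExp → BExp
  _band_ : BExp → BExp → BExp

⟦_⟧ : Exp → Store → Val
⟦ var x ⟧ s = s x
⟦ lit n ⟧ s = n
⟦ e ⊕ e' ⟧ s = ⟦ e ⟧ s + ⟦ e' ⟧ s
⟦ e ⊖ e' ⟧ s = ⟦ e ⟧ s ∸ ⟦ e' ⟧ s

⟦_⟧b : BExp → Store → Bool
⟦ tt ⟧b s = true
⟦ ff ⟧b s = false
⟦ e == e' ⟧b s = ⟦ e ⟧ s ≡ᵇ ⟦ e' ⟧ s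
⟦ e <= e' ⟧b s = ⟦ e ⟧ s ≤ᵇ ⟦ e' ⟧ s
⟦ bnot B ⟧b s = not (⟦ B ⟧b s)
⟦ B band B' ⟧b s = ⟦ B ⟧b s ∧ ⟦ B' ⟧b s

fvE : Exp → List Var
fvE (var x) = x ∷ []
fvE (lit n) = []
fvE (e ⊕ e') = fvE e ++ fvE e'
fvE (e ⊖ e') = fvE e ++ fvE e'

fvB : BExp → List Var
fvB tt = []
fvB ff = []
fvB (e == e') = fvE e ++ fvE e'
fvB (e <= e') = fvE e ++ fvE e'
fvB (bnot B) = fvB B
fvB (B band B') = fvB B ++ fvB B'

data Assn : Set where
  pure      : BExp → Assn
  emp       : Assn
  _↦_       : Exp → Exp → Assn
  _∧'_      : Assn → Assn → Assn
  _∨'_      : Assn → Assn → Assn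
  _⇒'_      : Assn → Assn → Assn
  _∗_       : Assn → Assn → Assn
  _-∗_      : Assn → Assn → Assn
  ∃'        : Var → Assn → Assn
  ∀'        : Var → Assn → Assn

_,_⊨_ : Store → Heap → Assn → Set
s , h ⊨ pure B = ⟦ B ⟧b s ≡ true
s , h ⊨ emp = ∀ l → at h l ≡ nothing
s , h ⊨ (e ↦ e') = (at h (⟦ e ⟧ s) ≡ just (⟦ e' ⟧ s))
                 × (∀ l → l ≢ ⟦ e ⟧ s → at h l ≡ nothing)
s , h ⊨ (P ∧' Q) = (s , h ⊨ P) × (s , h ⊨ Q)
s , h ⊨ (P ∨' Q) = (s , h ⊨ P) ⊎ (s , h ⊨ Q)
s , h ⊨ (P ⇒' Q) = (s , h ⊨ P) → (s , h ⊨ Q)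
s , h ⊨ (P ∗ Q) = Σ Heap λ h₁ → Σ Heap λ h₂ →
                    Join h₁ h₂ h × (s , h₁ ⊨ P) × (s , h₂ ⊨ Q)
s , h ⊨ (P -∗ Q) = ∀ h₁ h₂ → Join h h₁ h₂ → (s , h₁ ⊨ P) → (s , h₂ ⊨ Q)
s , h ⊨ ∃' x P = Σ Val λ v → (s [ x ↦ v ]) , h ⊨ P
s , h ⊨ ∀' x P = ∀ v → (s [ x ↦ v ]) , h ⊨ P

FV : Assn → List Var
FV (pure B) = fvB B
FV emp = []
FV (e ↦ e') = fvE e ++ fvE e'
FV (P ∧' Q) = FV P ++ FV Q
FV (P ∨' Q) = FV P ++ FV Q
FV (P ⇒' Q) = FV P ++ FV Q
FV (P ∗ Q) = FV P ++ FV Q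
FV (P -∗ Q) = FV P ++ FV Q
FV (∃' x P) = filter (λ y → ¬? (y ≟ x)) (FV P)
FV (∀' x P) = filter (λ y → ¬? (y ≟ x)) (FV P)

_⊆V_ : List Var → VarSet → Set
xs ⊆V A = ∀ {x} → x ∈ xs → A x

Precise : Assn → Set
Precise R = ∀ s h h₁ h₂ → h₁ ⊑ h → h₂ ⊑ h →
            s , h₁ ⊨ R → s , h₂ ⊨ R → h₁ ≗h h₂

-- Resource configurations  (O , L , D) : each resource name is
-- outside ρ, in O (owned), in L (locked) or in D (available).
-- A map to this four-element type is exactly a triple of pairwise
-- disjoint sets of resource names.

data RStatus : Set where
  none own lck avl : RStatus

RConf : Set
RConf = ResName → RStatus

_≟s_ : RStatus → RStatus → Bool
none ≟s none = true
own ≟s own = true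
lck ≟s lck = true
avl ≟s avl = true
_ ≟s _ = false

-- ρ[r ≔ st]: used for  ρ ∖ {r}  (st = none),  O ∪ {r}  (st = own),
-- D ∪ {r} (st = avl)
_[_≔_]ρ : RConf → ResName → RStatus → RConf
(ρ [ r ≔ st ]ρ) r' with r' ≟ r
... | yes _ = st
... | no  _ = ρ r'

InLD : RStatus → Set
InLD st = (st ≡ lck) ⊎ (st ≡ avl)

record REntry : Set₁ where
  constructor entry
  field
    name : ResName
    vars : VarSet
    inv  : Assn
open REntry public

data RCtx : Set₁ where
  ε   : RCtx
  _▸_ : RCtx → REntry → RCtx

names : RCtx → List ResName
names ε = []
names (Γ ▸ e) = name e ∷ names Γ

IsResCtx : RCtx → Set
IsResCtx ε = ⊤
IsResCtx (Γ ▸ e) = IsResCtx Γ × (name e ∉ names Γ)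
                 × Precise (inv e) × (FV (inv e) ⊆V vars e)

PV : RCtx → ResName → VarSet
PV ε r x = ⊥
PV (Γ ▸ e) r x with name e ≟ r
... | yes _ = vars e x
... | no  _ = PV Γ r x

addIfAvl : RStatus → Assn → Assn → Assn
addIfAvl avl P R = P ∗ R
addIfAvl _   P R = P

⊛ : RCtx → RConf → Assn
⊛ ε ρ = emp
⊛ (Γ ▸ e) ρ = addIfAvl (ρ (name e)) (⊛ Γ ρ) (inv e)

data BCmd : Set where
  assign  : Var → Exp → BCmd
  load    : Var → Exp → BCmd
  store   : Exp → Exp → BCmd
  cons    : Var → List Exp → BCmd
  dispose : Exp → BCmd

data Cmd : Set where
  skip           : Cmd
  basic          : BCmd → Cmd
  _⨾_            : Cmd → Cmd → Cmd
  if_then_else_  : BExp → Cmd → Cmd → Cmd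
  while_loop_      : BExp → Cmd → Cmd
  resource_inside_   : ResName → Cmd → Cmd
  withr_when_run_ : ResName → BExp → Cmd → Cmd
  _∥_            : Cmd → Cmd → Cmd
  within_run_     : ResName → Cmd → Cmd

Unextended : Cmd → Set
Unextended skip = ⊤
Unextended (basic c) = ⊤
Unextended (C₁ ⨾ C₂) = Unextended C₁ × Unextended C₂
Unextended (if B then C₁ else C₂) = Unextended C₁ × Unextended C₂
Unextended (while B loop C) = Unextended C
Unextended (resource r inside C) = Unextended C
Unextended (withr r when B run C) = Unextended C
Unextended (C₁ ∥ C₂) = Unextended C₁ × Unextended C₂
Unextended (within r run C) = ⊥

Locked : Cmd → ResName → Set
Locked (C₁ ⨾ C₂) r' = Locked C₁ r'
Locked (C₁ ∥ C₂) r' = Locked C₁ r' ⊎ Locked C₂ r'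
Locked (resource r inside C) r' = Locked C r' × r' ≢ r
Locked (within r run C) r' = Locked C r' ⊎ r' ≡ r
Locked _ r' = ⊥

chngB : BCmd → Var → Set
chngB (assign x e) y = y ≡ x
chngB (load x e) y = y ≡ x
chngB (cons x es) y = y ≡ x
chngB _ y = ⊥

chng : Cmd → Var → Set
chng (basic c) y = chngB c y
chng (C₁ ⨾ C₂) y = chng C₁ y
chng (C₁ ∥ C₂) y = chng C₁ y ⊎ chng C₂ y
chng (resource r inside C) y = chng C y
chng (within r run C) y = chng C y
chng _ y = ⊥

data BStep : BCmd → Store → Heap → Store → Heap → Set where
  b-assign : ∀ {x e s h h'} → h ≗h h' →
    BStep (assign x e) s h (s [ x ↦ ⟦ e ⟧ s ]) h'
  b-load : ∀ {x e s h h' v} → at h (⟦ e ⟧ s) ≡ just v → h ≗h h' →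
    BStep (load x e) s h (s [ x ↦ v ]) h'
  b-store : ∀ {e e' s h h' v} → at h (⟦ e ⟧ s) ≡ just v →
    at h' (⟦ e ⟧ s) ≡ just (⟦ e' ⟧ s) →
    (∀ l → l ≢ ⟦ e ⟧ s → at h' l ≡ at h l) →
    BStep (store e e') s h s h'
  b-cons : ∀ {x es s h h'} (l : Loc) →
    (∀ (i : Fin (length es)) → at h (l + toℕ i) ≡ nothing) →
    (∀ (i : Fin (length es)) → at h' (l + toℕ i) ≡ just (⟦ lookup es i ⟧ s)) →
    (∀ l' → (∀ (i : Fin (length es)) → l' ≢ l + toℕ i) → at h' l' ≡ at h l') →
    BStep (cons x es) s h (s [ x ↦ l ]) h'
  b-dispose : ∀ {e s h h' v} → at h (⟦ e ⟧ s) ≡ just v →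
    at h' (⟦ e ⟧ s) ≡ nothing →
    (∀ l → l ≢ ⟦ e ⟧ s → at h' l ≡ at h l) →
    BStep (dispose e) s h s h'

data BAbort : BCmd → Store → Heap → Set where
  a-load    : ∀ {x e s h} → at h (⟦ e ⟧ s) ≡ nothing → BAbort (load x e) s h
  a-store   : ∀ {e e' s h} → at h (⟦ e ⟧ s) ≡ nothing → BAbort (store e e') s h
  a-dispose : ∀ {e s h} → at h (⟦ e ⟧ s) ≡ nothing → BAbort (dispose e) s h

data Step : Cmd → Store → Heap → RConf → Cmd → Store → Heap → RConf → Set where
  S1  : ∀ {C₂ s h ρ} → Step (skip ⨾ C₂) s h ρ C₂ s h ρ
  S2  : ∀ {C₁ C₁' C₂ s h ρ s' h' ρ'} → Step C₁ s h ρ C₁' s' h' ρ' →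
        Step (C₁ ⨾ C₂) s h ρ (C₁' ⨾ C₂) s' h' ρ'
  LP  : ∀ {B C s h ρ} →
        Step (while B loop C) s h ρ (if B then (C ⨾ (while B loop C)) else skip) s h ρ
  IF1 : ∀ {B C₁ C₂ s h ρ} → ⟦ B ⟧b s ≡ true →
        Step (if B then C₁ else C₂) s h ρ C₁ s h ρ
  IF2 : ∀ {B C₁ C₂ s h ρ} → ⟦ B ⟧b s ≡ false →
        Step (if B then C₁ else C₂) s h ρ C₂ s h ρ
  P1  : ∀ {C₁ C₁' C₂ s h ρ s' h' ρ'} → Step C₁ s h ρ C₁' s' h' ρ' →
        Step (C₁ ∥ C₂) s h ρ (C₁' ∥ C₂) s' h' ρ'
  P2  : ∀ {C₁ C₂ C₂' s h ρ s' h' ρ'} → Step C₂ s h ρ C₂' s' h' ρ' →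
        Step (C₁ ∥ C₂) s h ρ (C₁ ∥ C₂') s' h' ρ'
  P3  : ∀ {s h ρ} → Step (skip ∥ skip) s h ρ skip s h ρ
  R0  : ∀ {r s h ρ} → ρ r ≡ none → Step (resource r inside skip) s h ρ skip s h ρ
  R1  : ∀ {r C C' s h ρ s' h' ρ'} → ρ r ≡ none → Locked C r →
        Step C s h (ρ [ r ≔ own ]ρ) C' s' h' ρ' →
        Step (resource r inside C) s h ρ (resource r inside C') s' h' (ρ' [ r ≔ none ]ρ)
  R2  : ∀ {r C C' s h ρ s' h' ρ'} → ρ r ≡ none → ¬ Locked C r →
        Step C s h (ρ [ r ≔ avl ]ρ) C' s' h' ρ' →
        Step (resource r inside C) s h ρ (resource r inside C') s' h' (ρ' [ r ≔ none ]ρ)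
  W0  : ∀ {r B C s h ρ} → ρ r ≡ avl → ⟦ B ⟧b s ≡ true →
        Step (withr r when B run C) s h ρ (within r run C) s h (ρ [ r ≔ own ]ρ)
  W1  : ∀ {r C C' s h ρ s' h' ρ'} → ρ r ≡ own →
        Step C s h (ρ [ r ≔ none ]ρ) C' s' h' ρ' →
        Step (within r run C) s h ρ (within r run C') s' h' (ρ' [ r ≔ own ]ρ)
  W2  : ∀ {r s h ρ} → ρ r ≡ own →
        Step (within r run skip) s h ρ skip s h (ρ [ r ≔ avl ]ρ)
  BCT : ∀ {c s h ρ s' h'} → BStep c s h s' h' →
        Step (basic c) s h ρ skip s' h' ρ

data Abort : Cmd → Store → Heap → RConf → Set where
  RA   : ∀ {r C s h ρ} → ρ r ≢ none → Abort (resource r inside C) s h ρ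
  WA   : ∀ {r B C s h ρ} → ρ r ≡ none → Abort (withr r when B run C) s h ρ
  RA1  : ∀ {r C s h ρ} → ρ r ≡ none → Locked C r →
         Abort C s h (ρ [ r ≔ own ]ρ) → Abort (resource r inside C) s h ρ
  RA2  : ∀ {r C s h ρ} → ρ r ≡ none → ¬ Locked C r →
         Abort C s h (ρ [ r ≔ avl ]ρ) → Abort (resource r inside C) s h ρ
  BCA  : ∀ {c s h ρ} → BAbort c s h → Abort (basic c) s h ρ
  SA   : ∀ {C₁ C₂ s h ρ} → Abort C₁ s h ρ → Abort (C₁ ⨾ C₂) s h ρ
  WA1  : ∀ {r C s h ρ} → Abort C s h (ρ [ r ≔ none ]ρ) → Abort (within r run C) s h ρ
  WA2  : ∀ {r C s h ρ} → ρ r ≢ own → Abort (within r run C) s h ρ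
  PA1  : ∀ {C₁ C₂ s h ρ} → Abort C₁ s h ρ → Abort (C₁ ∥ C₂) s h ρ
  PA2  : ∀ {C₁ C₂ s h ρ} → Abort C₂ s h ρ → Abort (C₁ ∥ C₂) s h ρ

data Steps : ℕ → Cmd → Store → Heap → RConf → Cmd → Store → Heap → RConf → Set where
  done : ∀ {C s h ρ} → Steps zero C s h ρ C s h ρ
  more : ∀ {k C s h ρ C₁ s₁ h₁ ρ₁ C' s' h' ρ'} →
         Step C s h ρ C₁ s₁ h₁ ρ₁ → Steps k C₁ s₁ h₁ ρ₁ C' s' h' ρ' →
         Steps (suc k) C s h ρ C' s' h' ρ'

AbortsIn : ℕ → Cmd → Store → Heap → RConf → Set
AbortsIn zero C s h ρ = ⊥
AbortsIn (suc j) C s h ρ =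
  Σ Cmd λ C'' → Σ Store λ s'' → Σ Heap λ h'' → Σ RConf λ ρ'' →
    Steps j C s h ρ C'' s'' h'' ρ'' × Abort C'' s'' h'' ρ''

Reachable : Cmd → Set
Reachable C' =
  Σ Cmd λ C₀ → Unextended C₀ ×
  Σ Store λ s → Σ Heap λ h → Σ RConf λ ρ →
  Σ Store λ s' → Σ Heap λ h' → Σ RConf λ ρ' → Σ ℕ λ k →
    Steps k C₀ s h ρ C' s' h' ρ' × (∀ j → j ≤ k → ¬ AbortsIn j C₀ s h ρ)

EnvStep : VarSet → RCtx → Cmd → Store → Heap → RConf → Store → Heap → RConf → Set
EnvStep A Γ C s ĥ ρ s' ĥ' ρ' =
  Σ Heap λ h → Σ Heap λ hG → Σ Heap λ hG' →
    Join h hG ĥ × Join h hG' ĥ' ×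
    (∀ x → (A x ⊎ Σ ResName λ r → Locked C r × PV Γ r x) → s x ≡ s' x) ×
    (∀ r → (ρ r ≡ own → ρ' r ≡ own) × (ρ' r ≡ own → ρ r ≡ own)) ×
    (∀ r → (InLD (ρ r) → InLD (ρ' r)) × (InLD (ρ' r) → InLD (ρ r))) ×
    (s , hG ⊨ ⊛ Γ ρ) × (s' , hG' ⊨ ⊛ Γ ρ')

data AStep (A : VarSet) (Γ : RCtx) :
     Cmd → Store → Heap → RConf → Cmd → Store → Heap → RConf → Set where
  prog : ∀ {C s h ρ C' s' h' ρ'} → Step C s h ρ C' s' h' ρ' →
         AStep A Γ C s h ρ C' s' h' ρ'
  env  : ∀ {C s h ρ s' h' ρ'} → EnvStep A Γ C s h ρ s' h' ρ' →
         AStep A Γ C s h ρ C s' h' ρ'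

Safe : ℕ → Cmd → Store → Heap → RConf → RCtx → Assn → VarSet → Set
Safe zero C s h ρ Γ Q A = ⊤
Safe (suc n) C s h ρ Γ Q A =
  (C ≡ skip → s , h ⊨ Q) ×
  (¬ Abort C s h ρ) ×
  (∀ x → chng C x → ¬ (Σ ResName λ r → InLD (ρ r) × PV Γ r x)) ×
  (∀ hG ĥ → Join h hG ĥ → s , hG ⊨ ⊛ Γ ρ →
    ∀ C' s' ĥ' ρ' → AStep A Γ C s ĥ ρ C' s' ĥ' ρ' →
    Σ Heap λ h' → Σ Heap λ hG' →
      Join h' hG' ĥ' × (s' , hG' ⊨ ⊛ Γ ρ') × Safe n C' s' h' ρ' Γ Q A)

-- While C runs inside  within r do C, the resource r is owned, so r(X):R is
-- invisible to the environment and Γ' behaves like Γ.  A step of the body or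
-- of the environment is therefore simulated by a step of C under Γ with r
-- removed (the environment may not touch X, as r is locked), and safety of
-- C is inherited.  At release, the local heap splits as Q ∗ R; the R part is
-- handed to the global heap, where it becomes the invariant of the now
-- available r, and skip stays safe for Q because the environment preserves
-- the variables of A ⊇ FV(Q) and, the invariants being precise, the local heap.
module Submission where

open import Defs
open import Data.Bool using (not; _∧_)
open import Data.Nat using (ℕ; zero; suc; _+_; _∸_; _≡ᵇ_; _≤ᵇ_)
open import Data.Nat.Properties using (_≟_)
open import Data.Maybe using (Maybe; just; nothing)
open import Data.List using (List; _++_; filter)
open import Data.List.Membership.Propositional using (_∈_; _∉_)
open import Data.List.Membership.Propositional.Properties using (∈-++⁺ˡ; ∈-++⁺ʳ; ∈-filter⁺)
open import Data.List.Relation.Unary.Any using (here; there)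
open import Data.Product using (Σ; _×_; _,_; proj₁; proj₂)
open import Data.Sum using (_⊎_; inj₁; inj₂)
open import Data.Unit using (tt)
open import Data.Empty using (⊥-elim)
open import Function using (id; _∘_)
open import Relation.Nullary using (¬_; yes; no; ¬?)
open import Relation.Binary.PropositionalEquality hiding ([_])

_≐_ : RConf → RConf → Set
ρ ≐ ρ' = ∀ r → ρ r ≡ ρ' r

≐-sym : ∀ {ρ ρ'} → ρ ≐ ρ' → ρ' ≐ ρ
≐-sym e r = sym (e r)

[≔]-same : ∀ ρ r st → (ρ [ r ≔ st ]ρ) r ≡ st
[≔]-same ρ r st with r ≟ r
... | yes _ = refl
... | no r≢r with () ← r≢r refl

[≔]-other : ∀ ρ r st r' → r' ≢ r → (ρ [ r ≔ st ]ρ) r' ≡ ρ r'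
[≔]-other ρ r st r' r'≢r with r' ≟ r
... | yes r'≡r with () ← r'≢r r'≡r
... | no _ = refl

[≔]-cong : ∀ {ρ ρ'} r st → ρ ≐ ρ' → (ρ [ r ≔ st ]ρ) ≐ (ρ' [ r ≔ st ]ρ)
[≔]-cong r st e r' with r' ≟ r
... | yes _ = refl
... | no _ = e r'

[≔]-undo : ∀ ρ r st {st'} → ρ r ≡ st' → ((ρ [ r ≔ st ]ρ) [ r ≔ st' ]ρ) ≐ ρ
[≔]-undo ρ r st e r' with r' ≟ r
... | yes refl = sym e
... | no r'≢r = [≔]-other ρ r st r' r'≢r

[≔]-resp-⇔ : ∀ (P : RStatus → Set) {ρ ρ'} r st →
             (∀ r' → (P (ρ r') → P (ρ' r')) × (P (ρ' r') → P (ρ r'))) →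
             ∀ r' → (P ((ρ [ r ≔ st ]ρ) r') → P ((ρ' [ r ≔ st ]ρ) r'))
                  × (P ((ρ' [ r ≔ st ]ρ) r') → P ((ρ [ r ≔ st ]ρ) r'))
[≔]-resp-⇔ P r st both r' with r' ≟ r
... | yes _ = id , id
... | no _ = both r'

¬InLD-own : ¬ InLD own
¬InLD-own (inj₁ ())
¬InLD-own (inj₂ ())

≢-by-status : ∀ {ρ : RConf} {r r₀ st} → ρ r ≡ none → ρ r₀ ≡ st → st ≢ none → r ≢ r₀
≢-by-status e e₀ st≢none refl = st≢none (trans (sym e₀) e)

[≔none]-none : ∀ ρ r₀ r → (r ≢ r₀ → ρ r ≡ none) → (ρ [ r₀ ≔ none ]ρ) r ≡ none
[≔none]-none ρ r₀ r elsewhere with r ≟ r₀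
... | yes _ = refl
... | no r≢r₀ = elsewhere r≢r₀

Step-preserves-none : ∀ {C s h ρ C' s' h' ρ'} r →
                      Step C s h ρ C' s' h' ρ' → ρ r ≡ none → ρ' r ≡ none
Step-preserves-none r S1 e = e
Step-preserves-none r (S2 st) e = Step-preserves-none r st e
Step-preserves-none r LP e = e
Step-preserves-none r (IF1 _) e = e
Step-preserves-none r (IF2 _) e = e
Step-preserves-none r (P1 st) e = Step-preserves-none r st e
Step-preserves-none r (P2 st) e = Step-preserves-none r st e
Step-preserves-none r P3 e = e
Step-preserves-none r (R0 _) e = e
Step-preserves-none r (R1 {r = r₀} {ρ = ρ} {ρ' = ρ₁} _ _ st) e =
  [≔none]-none ρ₁ r₀ r λ r≢r₀ → Step-preserves-none r st (trans ([≔]-other ρ r₀ own r r≢r₀) e)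
Step-preserves-none r (R2 {r = r₀} {ρ = ρ} {ρ' = ρ₁} _ _ st) e =
  [≔none]-none ρ₁ r₀ r λ r≢r₀ → Step-preserves-none r st (trans ([≔]-other ρ r₀ avl r r≢r₀) e)
Step-preserves-none r (W0 {r = r₀} {ρ = ρ} e₀ _) e =
  trans ([≔]-other ρ r₀ own r (≢-by-status {ρ = ρ} e e₀ λ ())) e
Step-preserves-none r (W1 {r = r₀} {ρ = ρ} {ρ' = ρ₁} e₀ st) e =
  let r≢r₀ = ≢-by-status {ρ = ρ} e e₀ λ () in
  trans ([≔]-other ρ₁ r₀ own r r≢r₀)
        (Step-preserves-none r st (trans ([≔]-other ρ r₀ none r r≢r₀) e))
Step-preserves-none r (W2 {r = r₀} {ρ = ρ} e₀) e =
  trans ([≔]-other ρ r₀ avl r (≢-by-status {ρ = ρ} e e₀ λ ())) e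
Step-preserves-none r (BCT _) e = e

-- Without function extensionality, configurations such as ρ [ r ≔ own ]ρ [ r ≔ none ]ρ
-- and ρ (for ρ r ≡ none) are only pointwise equal, so steps and safety are
-- transported along ≐.
Step-resp-≐ : ∀ {C s h ρ₁ C' s' h' ρ₁' ρ₂} → Step C s h ρ₁ C' s' h' ρ₁' → ρ₁ ≐ ρ₂ →
              Σ RConf λ ρ₂' → Step C s h ρ₂ C' s' h' ρ₂' × ρ₁' ≐ ρ₂'
Step-resp-≐ {ρ₂ = ρ₂} S1 e = ρ₂ , S1 , e
Step-resp-≐ (S2 st) e with Step-resp-≐ st e
... | ρ₂' , st' , e' = ρ₂' , S2 st' , e'
Step-resp-≐ {ρ₂ = ρ₂} LP e = ρ₂ , LP , e
Step-resp-≐ {ρ₂ = ρ₂} (IF1 b) e = ρ₂ , IF1 b , e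
Step-resp-≐ {ρ₂ = ρ₂} (IF2 b) e = ρ₂ , IF2 b , e
Step-resp-≐ (P1 st) e with Step-resp-≐ st e
... | ρ₂' , st' , e' = ρ₂' , P1 st' , e'
Step-resp-≐ (P2 st) e with Step-resp-≐ st e
... | ρ₂' , st' , e' = ρ₂' , P2 st' , e'
Step-resp-≐ {ρ₂ = ρ₂} P3 e = ρ₂ , P3 , e
Step-resp-≐ {ρ₂ = ρ₂} (R0 {r = r} n) e = ρ₂ , R0 (trans (sym (e r)) n) , e
Step-resp-≐ (R1 {r = r} n lk st) e with Step-resp-≐ st ([≔]-cong r own e)
... | ρ₂' , st' , e' = ρ₂' [ r ≔ none ]ρ , R1 (trans (sym (e r)) n) lk st' , [≔]-cong r none e'
Step-resp-≐ (R2 {r = r} n lk st) e with Step-resp-≐ st ([≔]-cong r avl e)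
... | ρ₂' , st' , e' = ρ₂' [ r ≔ none ]ρ , R2 (trans (sym (e r)) n) lk st' , [≔]-cong r none e'
Step-resp-≐ {ρ₂ = ρ₂} (W0 {r = r} a b) e =
  ρ₂ [ r ≔ own ]ρ , W0 (trans (sym (e r)) a) b , [≔]-cong r own e
Step-resp-≐ (W1 {r = r} o st) e with Step-resp-≐ st ([≔]-cong r none e)
... | ρ₂' , st' , e' = ρ₂' [ r ≔ own ]ρ , W1 (trans (sym (e r)) o) st' , [≔]-cong r own e'
Step-resp-≐ {ρ₂ = ρ₂} (W2 {r = r} o) e =
  ρ₂ [ r ≔ avl ]ρ , W2 (trans (sym (e r)) o) , [≔]-cong r avl e
Step-resp-≐ {ρ₂ = ρ₂} (BCT b) e = ρ₂ , BCT b , e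

Abort-resp-≐ : ∀ {C s h ρ₁ ρ₂} → Abort C s h ρ₁ → ρ₁ ≐ ρ₂ → Abort C s h ρ₂
Abort-resp-≐ (RA {r = r} n) e = RA (n ∘ trans (e r))
Abort-resp-≐ (WA {r = r} n) e = WA (trans (sym (e r)) n)
Abort-resp-≐ (RA1 {r = r} n lk a) e = RA1 (trans (sym (e r)) n) lk (Abort-resp-≐ a ([≔]-cong r own e))
Abort-resp-≐ (RA2 {r = r} n lk a) e = RA2 (trans (sym (e r)) n) lk (Abort-resp-≐ a ([≔]-cong r avl e))
Abort-resp-≐ (BCA b) e = BCA b
Abort-resp-≐ (SA a) e = SA (Abort-resp-≐ a e)
Abort-resp-≐ (WA1 {r = r} a) e = WA1 (Abort-resp-≐ a ([≔]-cong r none e))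
Abort-resp-≐ (WA2 {r = r} n) e = WA2 (n ∘ trans (e r))
Abort-resp-≐ (PA1 a) e = PA1 (Abort-resp-≐ a e)
Abort-resp-≐ (PA2 a) e = PA2 (Abort-resp-≐ a e)

⊛-cong : ∀ Γ ρ ρ' → (∀ r → r ∈ names Γ → ρ r ≡ ρ' r) → ⊛ Γ ρ ≡ ⊛ Γ ρ'
⊛-cong ε ρ ρ' e = refl
⊛-cong (Γ ▸ en) ρ ρ' e =
  cong₂ (λ st P → addIfAvl st P (inv en)) (e (name en) (here refl))
        (⊛-cong Γ ρ ρ' (λ r → e r ∘ there))

⊛-≐ : ∀ Γ {ρ ρ'} → ρ ≐ ρ' → ⊛ Γ ρ ≡ ⊛ Γ ρ'
⊛-≐ Γ e = ⊛-cong Γ _ _ (λ r _ → e r)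

⊛-[≔]-fresh : ∀ Γ ρ r st → r ∉ names Γ → ⊛ Γ (ρ [ r ≔ st ]ρ) ≡ ⊛ Γ ρ
⊛-[≔]-fresh Γ ρ r st r∉Γ =
  ⊛-cong Γ _ ρ λ r' r'∈Γ → [≔]-other ρ r st r' λ { refl → r∉Γ r'∈Γ }

PV-fresh : ∀ Γ r x → r ∉ names Γ → ¬ PV Γ r x
PV-fresh (Γ ▸ en) r x r∉Γ pv with name en ≟ r
... | yes refl = r∉Γ (here refl)
... | no _ = PV-fresh Γ r x (r∉Γ ∘ there) pv

PV-▸-here : ∀ Γ r X R x → X x → PV (Γ ▸ entry r X R) r x
PV-▸-here Γ r X R x x∈X with r ≟ r
... | yes _ = x∈X
... | no r≢r with () ← r≢r refl

PV-▸-there : ∀ Γ r X R r' x → r ≢ r' → PV Γ r' x → PV (Γ ▸ entry r X R) r' x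
PV-▸-there Γ r X R r' x r≢r' pv with r ≟ r'
... | yes r≡r' with () ← r≢r' r≡r'
... | no _ = pv

EnvStep-resp-≐ : ∀ {A Γ C s ĥ ρ₁ ρ₂ s' ĥ' ρ'} → ρ₁ ≐ ρ₂ →
                 EnvStep A Γ C s ĥ ρ₂ s' ĥ' ρ' → EnvStep A Γ C s ĥ ρ₁ s' ĥ' ρ'
EnvStep-resp-≐ {Γ = Γ} {s = s} e (h , hG , hG' , j , j' , agree , own⇔ , ld⇔ , sat , sat') =
  h , hG , hG' , j , j' , agree ,
  (λ r → proj₁ (own⇔ r) ∘ trans (sym (e r)) , trans (e r) ∘ proj₂ (own⇔ r)) ,
  (λ r → proj₁ (ld⇔ r) ∘ subst InLD (e r) , subst InLD (sym (e r)) ∘ proj₂ (ld⇔ r)) ,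
  subst (s , hG ⊨_) (⊛-≐ Γ (≐-sym e)) sat , sat'

SafeSplit : ℕ → RCtx → Assn → VarSet → Cmd → Store → Heap → RConf → Set
SafeSplit n Γ Q A C' s' ĥ' ρ' =
  Σ Heap λ h' → Σ Heap λ hG' → Join h' hG' ĥ' × (s' , hG' ⊨ ⊛ Γ ρ') × Safe n C' s' h' ρ' Γ Q A

Safe-resp-≐ : ∀ n {C s h ρ₁ ρ₂ Γ Q A} → ρ₁ ≐ ρ₂ → Safe n C s h ρ₁ Γ Q A → Safe n C s h ρ₂ Γ Q A
Safe-resp-≐ zero e _ = tt
Safe-resp-≐ (suc n) {C} {s} {h} {ρ₁} {ρ₂} {Γ} {Q} {A} e (final , ¬abort , no-chng , continue) =
  final , ¬abort ∘ (λ a → Abort-resp-≐ a (≐-sym e)) ,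
  (λ { x c (r , ld , pv) → no-chng x c (r , subst InLD (sym (e r)) ld , pv) }) ,
  continue'
  where
  continue' : ∀ hG ĥ → Join h hG ĥ → s , hG ⊨ ⊛ Γ ρ₂ →
              ∀ C' s' ĥ' ρ' → AStep A Γ C s ĥ ρ₂ C' s' ĥ' ρ' → SafeSplit n Γ Q A C' s' ĥ' ρ'
  continue' hG ĥ j sat C' s' ĥ' ρ' (prog st) with Step-resp-≐ st (≐-sym e)
  ... | ρ₁' , st' , e' with continue hG ĥ j (subst (s , hG ⊨_) (⊛-≐ Γ (≐-sym e)) sat) C' s' ĥ' ρ₁' (prog st')
  ... | h' , hG' , j' , sat' , safe' =
    h' , hG' , j' , subst (s' , hG' ⊨_) (⊛-≐ Γ (≐-sym e')) sat' , Safe-resp-≐ n (≐-sym e') safe'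
  continue' hG ĥ j sat _ s' ĥ' ρ' (env es) =
    continue hG ĥ j (subst (s , hG ⊨_) (⊛-≐ Γ (≐-sym e)) sat) C s' ĥ' ρ'
      (env (EnvStep-resp-≐ {A} {Γ} {C} {s} {ĥ} {ρ₁} {ρ₂} {s'} {ĥ'} {ρ'} e es))

Joins : Maybe Val → Maybe Val → Maybe Val → Set
Joins a b c = (a ≡ nothing × c ≡ b) ⊎ (b ≡ nothing × c ≡ a)

joins-functional : ∀ {a b c c'} → Joins a b c → Joins a b c' → c ≡ c'
joins-functional (inj₁ (refl , refl)) (inj₁ (_ , refl)) = refl
joins-functional (inj₁ (refl , refl)) (inj₂ (refl , refl)) = refl
joins-functional (inj₂ (refl , refl)) (inj₁ (refl , refl)) = refl
joins-functional (inj₂ (refl , refl)) (inj₂ (_ , refl)) = refl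

joins-cancelʳ : ∀ {a a' b c} → Joins a b c → Joins a' b c → a ≡ a'
joins-cancelʳ (inj₁ (refl , refl)) (inj₁ (refl , _)) = refl
joins-cancelʳ (inj₁ (refl , refl)) (inj₂ (refl , refl)) = refl
joins-cancelʳ (inj₂ (refl , refl)) (inj₁ (refl , refl)) = refl
joins-cancelʳ (inj₂ (refl , refl)) (inj₂ (_ , refl)) = refl

_∖ₘ_ : Maybe Val → Maybe Val → Maybe Val
x ∖ₘ just _ = nothing
x ∖ₘ nothing = x

nothing-∖ₘ : ∀ m → nothing ∖ₘ m ≡ nothing
nothing-∖ₘ (just _) = refl
nothing-∖ₘ nothing = refl

joins-∖ˡ : ∀ {a b c g x} → Joins a b c → Joins c g x → Joins a (x ∖ₘ a) x
joins-∖ˡ {nothing} _ _ = inj₁ (refl , refl)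
joins-∖ˡ {just _} (inj₁ (() , _)) _
joins-∖ˡ {just _} (inj₂ (_ , refl)) (inj₁ (() , _))
joins-∖ˡ {just _} (inj₂ (_ , refl)) (inj₂ (_ , refl)) = inj₂ (refl , refl)

joins-∖ʳ : ∀ {a b c g x} → Joins a b c → Joins c g x → Joins g b (x ∖ₘ a)
joins-∖ʳ {just _} (inj₁ (() , _)) _
joins-∖ʳ {just _} (inj₂ (_ , refl)) (inj₁ (() , _))
joins-∖ʳ {just _} (inj₂ (refl , refl)) (inj₂ (refl , refl)) = inj₁ (refl , refl)
joins-∖ʳ {nothing} (inj₁ (_ , refl)) (inj₁ (refl , refl)) = inj₂ (refl , refl)
joins-∖ʳ {nothing} (inj₂ (refl , refl)) (inj₁ (_ , refl)) = inj₂ (refl , refl)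
joins-∖ʳ {nothing} (inj₁ (_ , refl)) (inj₂ (refl , refl)) = inj₁ (refl , refl)
joins-∖ʳ {nothing} (inj₂ (refl , refl)) (inj₂ (refl , refl)) = inj₁ (refl , refl)

_∖ₕ_ : Heap → Heap → Heap
ĥ ∖ₕ h = record
  { at = λ l → at ĥ l ∖ₘ at h l
  ; bound = bound ĥ
  ; finite = λ l bound≤l → trans (cong (_∖ₘ at h l) (finite ĥ l bound≤l)) (nothing-∖ₘ (at h l))
  }

Join-reassoc : ∀ {h₁ h₂ h hG ĥ} → Join h₁ h₂ h → Join h hG ĥ →
               Join h₁ (ĥ ∖ₕ h₁) ĥ × Join hG h₂ (ĥ ∖ₕ h₁)
Join-reassoc j j' = (λ l → joins-∖ˡ (j l) (j' l)) , (λ l → joins-∖ʳ (j l) (j' l))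

Join-≗ : ∀ {a b h a' b' h'} → Join a b h → Join a' b' h' → a ≗h a' → b ≗h b' → h ≗h h'
Join-≗ {h' = h'} j j' ea eb l =
  joins-functional (j l) (subst₂ (λ x y → Joins x y (at h' l)) (sym (ea l)) (sym (eb l)) (j' l))

Join-cancelʳ : ∀ {h g h' g' ĥ} → Join h g ĥ → Join h' g' ĥ → g ≗h g' → h ≗h h'
Join-cancelʳ {h' = h'} {ĥ = ĥ} j j' eg l =
  joins-cancelʳ (j l) (subst (λ y → Joins (at h' l) y (at ĥ l)) (sym (eg l)) (j' l))

Join-⊑ˡ : ∀ {a b h} → Join a b h → a ⊑ h
Join-⊑ˡ j l v e with j l
... | inj₁ (a≡nothing , _) with () ← trans (sym a≡nothing) e
... | inj₂ (_ , h≡a) = trans h≡a e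

Join-⊑ʳ : ∀ {a b h} → Join a b h → b ⊑ h
Join-⊑ʳ j l v e with j l
... | inj₁ (_ , h≡b) = trans h≡b e
... | inj₂ (b≡nothing , _) with () ← trans (sym b≡nothing) e

Join-resp-≗ : ∀ {a b h h'} → h ≗h h' → Join a b h → Join a b h'
Join-resp-≗ e j l with j l
... | inj₁ (a≡nothing , h≡b) = inj₁ (a≡nothing , trans (sym (e l)) h≡b)
... | inj₂ (b≡nothing , h≡a) = inj₂ (b≡nothing , trans (sym (e l)) h≡a)

Join-respˡ-≗ : ∀ {a a' b h} → a ≗h a' → Join a b h → Join a' b h
Join-respˡ-≗ e j l with j l
... | inj₁ (a≡nothing , h≡b) = inj₁ (trans (sym (e l)) a≡nothing , h≡b)
... | inj₂ (b≡nothing , h≡a) = inj₂ (b≡nothing , trans h≡a (e l))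

⊑-trans : ∀ {a b c} → a ⊑ b → b ⊑ c → a ⊑ c
⊑-trans p q l v e = q l v (p l v e)

≗h-sym : ∀ {h h'} → h ≗h h' → h' ≗h h
≗h-sym e l = sym (e l)

precise-emp : Precise emp
precise-emp s h h₁ h₂ _ _ e₁ e₂ l = trans (e₁ l) (sym (e₂ l))

precise-∗ : ∀ P R → Precise P → Precise R → Precise (P ∗ R)
precise-∗ P R pP pR s h h₁ h₂ h₁⊑h h₂⊑h (a₁ , b₁ , j₁ , pa₁ , rb₁) (a₂ , b₂ , j₂ , pa₂ , rb₂) =
  Join-≗ {a₁} {b₁} {h₁} {a₂} {b₂} {h₂} j₁ j₂
    (pP s h a₁ a₂ (⊑-trans {a₁} {h₁} {h} (Join-⊑ˡ {a₁} {b₁} {h₁} j₁) h₁⊑h)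
                  (⊑-trans {a₂} {h₂} {h} (Join-⊑ˡ {a₂} {b₂} {h₂} j₂) h₂⊑h) pa₁ pa₂)
    (pR s h b₁ b₂ (⊑-trans {b₁} {h₁} {h} (Join-⊑ʳ {a₁} {b₁} {h₁} j₁) h₁⊑h)
                  (⊑-trans {b₂} {h₂} {h} (Join-⊑ʳ {a₂} {b₂} {h₂} j₂) h₂⊑h) rb₁ rb₂)

precise-⊛ : ∀ Γ ρ → IsResCtx Γ → Precise (⊛ Γ ρ)
precise-⊛ ε ρ _ = precise-emp
precise-⊛ (Γ ▸ en) ρ (Γ-ok , _ , precise-inv , _) with ρ (name en)
... | none = precise-⊛ Γ ρ Γ-ok
... | own = precise-⊛ Γ ρ Γ-ok
... | lck = precise-⊛ Γ ρ Γ-ok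
... | avl = precise-∗ (⊛ Γ ρ) (inv en) (precise-⊛ Γ ρ Γ-ok) precise-inv

local-heap-unique : ∀ Γ ρ s h hG h' hG' ĥ → IsResCtx Γ →
                    Join h hG ĥ → Join h' hG' ĥ →
                    s , hG ⊨ ⊛ Γ ρ → s , hG' ⊨ ⊛ Γ ρ → h ≗h h'
local-heap-unique Γ ρ s h hG h' hG' ĥ Γ-ok j j' sat sat' =
  Join-cancelʳ {h} {hG} {h'} {hG'} {ĥ} j j'
    (precise-⊛ Γ ρ Γ-ok s ĥ hG hG' (Join-⊑ʳ {h} {hG} {ĥ} j) (Join-⊑ʳ {h'} {hG'} {ĥ} j') sat sat')

Agree : List Var → Store → Store → Set
Agree xs s s' = ∀ {x} → x ∈ xs → s x ≡ s' x

Agree-sym : ∀ {xs s s'} → Agree xs s s' → Agree xs s' s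
Agree-sym ag m = sym (ag m)

Agree-++ˡ : ∀ {xs ys s s'} → Agree (xs ++ ys) s s' → Agree xs s s'
Agree-++ˡ ag m = ag (∈-++⁺ˡ m)

Agree-++ʳ : ∀ xs {ys s s'} → Agree (xs ++ ys) s s' → Agree ys s s'
Agree-++ʳ xs ag m = ag (∈-++⁺ʳ xs m)

⟦⟧-agree : ∀ e {s s'} → Agree (fvE e) s s' → ⟦ e ⟧ s ≡ ⟦ e ⟧ s'
⟦⟧-agree (var x) ag = ag (here refl)
⟦⟧-agree (lit n) ag = refl
⟦⟧-agree (e ⊕ e') ag = cong₂ _+_ (⟦⟧-agree e (Agree-++ˡ ag)) (⟦⟧-agree e' (Agree-++ʳ (fvE e) ag))
⟦⟧-agree (e ⊖ e') ag = cong₂ _∸_ (⟦⟧-agree e (Agree-++ˡ ag)) (⟦⟧-agree e' (Agree-++ʳ (fvE e) ag))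

⟦⟧b-agree : ∀ B {s s'} → Agree (fvB B) s s' → ⟦ B ⟧b s ≡ ⟦ B ⟧b s'
⟦⟧b-agree tt ag = refl
⟦⟧b-agree ff ag = refl
⟦⟧b-agree (e == e') ag = cong₂ _≡ᵇ_ (⟦⟧-agree e (Agree-++ˡ ag)) (⟦⟧-agree e' (Agree-++ʳ (fvE e) ag))
⟦⟧b-agree (e <= e') ag = cong₂ _≤ᵇ_ (⟦⟧-agree e (Agree-++ˡ ag)) (⟦⟧-agree e' (Agree-++ʳ (fvE e) ag))
⟦⟧b-agree (bnot B) ag = cong not (⟦⟧b-agree B ag)
⟦⟧b-agree (B band B') ag = cong₂ _∧_ (⟦⟧b-agree B (Agree-++ˡ ag)) (⟦⟧b-agree B' (Agree-++ʳ (fvB B) ag))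

Agree-bind : ∀ P x v {s s'} → Agree (filter (λ y → ¬? (y ≟ x)) (FV P)) s s' →
             Agree (FV P) (s [ x ↦ v ]) (s' [ x ↦ v ])
Agree-bind P x v ag {y} y∈P with y ≟ x
... | yes _ = refl
... | no y≢x = ag (∈-filter⁺ (λ y → ¬? (y ≟ x)) y∈P y≢x)

⊨-agree : ∀ P s s' h → Agree (FV P) s s' → s , h ⊨ P → s' , h ⊨ P
⊨-agree (pure B) s s' h ag p = trans (sym (⟦⟧b-agree B ag)) p
⊨-agree emp s s' h ag p = p
⊨-agree (e ↦ e') s s' h ag (pt , rest) =
  subst₂ (λ a b → at h a ≡ just b) ⟦e⟧-agree (⟦⟧-agree e' (Agree-++ʳ (fvE e) ag)) pt ,
  λ l l≢e → rest l (l≢e ∘ λ l≡e → trans l≡e ⟦e⟧-agree)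
  where
  ⟦e⟧-agree : ⟦ e ⟧ s ≡ ⟦ e ⟧ s'
  ⟦e⟧-agree = ⟦⟧-agree e (Agree-++ˡ ag)
⊨-agree (P ∧' Q) s s' h ag (p , q) =
  ⊨-agree P s s' h (Agree-++ˡ ag) p , ⊨-agree Q s s' h (Agree-++ʳ (FV P) ag) q
⊨-agree (P ∨' Q) s s' h ag (inj₁ p) = inj₁ (⊨-agree P s s' h (Agree-++ˡ ag) p)
⊨-agree (P ∨' Q) s s' h ag (inj₂ q) = inj₂ (⊨-agree Q s s' h (Agree-++ʳ (FV P) ag) q)
⊨-agree (P ⇒' Q) s s' h ag f p =
  ⊨-agree Q s s' h (Agree-++ʳ (FV P) ag) (f (⊨-agree P s' s h (Agree-sym (Agree-++ˡ ag)) p))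
⊨-agree (P ∗ Q) s s' h ag (h₁ , h₂ , j , p , q) =
  h₁ , h₂ , j , ⊨-agree P s s' h₁ (Agree-++ˡ ag) p , ⊨-agree Q s s' h₂ (Agree-++ʳ (FV P) ag) q
⊨-agree (P -∗ Q) s s' h ag f h₁ h₂ j p =
  ⊨-agree Q s s' h₂ (Agree-++ʳ (FV P) ag) (f h₁ h₂ j (⊨-agree P s' s h₁ (Agree-sym (Agree-++ˡ ag)) p))
⊨-agree (∃' x P) s s' h ag (v , p) = v , ⊨-agree P _ _ h (Agree-bind P x v ag) p
⊨-agree (∀' x P) s s' h ag f v = ⊨-agree P _ _ h (Agree-bind P x v ag) (f v)

⊨-≗h : ∀ P {s} h h' → h ≗h h' → s , h ⊨ P → s , h' ⊨ P
⊨-≗h (pure B) h h' e p = p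
⊨-≗h emp h h' e p l = trans (sym (e l)) (p l)
⊨-≗h (e₁ ↦ e₂) h h' e (pt , rest) = trans (sym (e _)) pt , λ l l≢e → trans (sym (e l)) (rest l l≢e)
⊨-≗h (P ∧' Q) h h' e (p , q) = ⊨-≗h P h h' e p , ⊨-≗h Q h h' e q
⊨-≗h (P ∨' Q) h h' e (inj₁ p) = inj₁ (⊨-≗h P h h' e p)
⊨-≗h (P ∨' Q) h h' e (inj₂ q) = inj₂ (⊨-≗h Q h h' e q)
⊨-≗h (P ⇒' Q) h h' e f p = ⊨-≗h Q h h' e (f (⊨-≗h P h' h (≗h-sym {h} {h'} e) p))
⊨-≗h (P ∗ Q) h h' e (h₁ , h₂ , j , p , q) = h₁ , h₂ , Join-resp-≗ {h₁} {h₂} {h} {h'} e j , p , q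
⊨-≗h (P -∗ Q) h h' e f h₁ h₂ j p = f h₁ h₂ (Join-respˡ-≗ {h'} {h} {h₁} {h₂} (≗h-sym {h} {h'} e) j) p
⊨-≗h (∃' x P) h h' e (v , p) = v , ⊨-≗h P h h' e p
⊨-≗h (∀' x P) h h' e f v = ⊨-≗h P h h' e (f v)

Safe-skip : ∀ n Γ ρ s h Q A → IsResCtx Γ → FV Q ⊆V A → s , h ⊨ Q → Safe n skip s h ρ Γ Q A
Safe-skip zero Γ ρ s h Q A Γ-ok FVQ⊆A q = tt
Safe-skip (suc n) Γ ρ s h Q A Γ-ok FVQ⊆A q = (λ _ → q) , (λ ()) , (λ _ ()) , continue
  where
  continue : ∀ hG ĥ → Join h hG ĥ → s , hG ⊨ ⊛ Γ ρ →
             ∀ C' s' ĥ' ρ' → AStep A Γ skip s ĥ ρ C' s' ĥ' ρ' → SafeSplit n Γ Q A C' s' ĥ' ρ'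
  continue hG ĥ j sat C' s' ĥ' ρ' (prog ())
  continue hG ĥ j sat _ s' ĥ' ρ' (env (h₁ , hG₁ , hG' , j₁ , j' , agree , _ , _ , sat₁ , sat')) =
    h₁ , hG' , j' , sat' ,
    Safe-skip n Γ ρ' s' h₁ Q A Γ-ok FVQ⊆A
      (⊨-agree Q s s' h₁ (λ m → agree _ (inj₁ (FVQ⊆A m)))
        (⊨-≗h Q h h₁ (local-heap-unique Γ ρ s h hG h₁ hG₁ ĥ Γ-ok j j₁ sat sat₁) q))

module WithinRule (Γ : RCtx) (Q R : Assn) (A X : VarSet) (r : ResName)
                  (Γ'-ok : IsResCtx (Γ ▸ entry r X R)) (FVQ⊆A : FV Q ⊆V A) where

  Γ' : RCtx
  Γ' = Γ ▸ entry r X R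

  r∉Γ : r ∉ names Γ
  r∉Γ = proj₁ (proj₂ Γ'-ok)

  ⊛Γ-[r≔] : ∀ ρ st → ⊛ Γ (ρ [ r ≔ st ]ρ) ≡ ⊛ Γ ρ
  ⊛Γ-[r≔] ρ st = ⊛-[≔]-fresh Γ ρ r st r∉Γ

  ⊛Γ'-own : ∀ {ρ} → ρ r ≡ own → ⊛ Γ' ρ ≡ ⊛ Γ ρ
  ⊛Γ'-own {ρ} r-own = cong (λ st → addIfAvl st (⊛ Γ ρ) R) r-own

  ⊛Γ'-avl : ∀ ρ → ⊛ Γ' (ρ [ r ≔ avl ]ρ) ≡ (⊛ Γ ρ ∗ R)
  ⊛Γ'-avl ρ = cong₂ (λ st P → addIfAvl st P R) ([≔]-same ρ r avl) (⊛Γ-[r≔] ρ avl)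

  ⊛Γ'-own-[r≔none] : ∀ {ρ} → ρ r ≡ own → ⊛ Γ' ρ ≡ ⊛ Γ (ρ [ r ≔ none ]ρ)
  ⊛Γ'-own-[r≔none] {ρ} r-own = trans (⊛Γ'-own r-own) (sym (⊛Γ-[r≔] ρ none))

  within-¬abort : ∀ {C s h ρ} → ρ r ≡ own → ¬ Abort C s h (ρ [ r ≔ none ]ρ) →
                  ¬ Abort (within r run C) s h ρ
  within-¬abort _ ¬abort (WA1 a) = ¬abort a
  within-¬abort r-own _ (WA2 r-not-own) = r-not-own r-own

  within-no-chng : ∀ {C ρ} → ρ r ≡ own →
    (∀ x → chng C x → ¬ (Σ ResName λ r' → InLD ((ρ [ r ≔ none ]ρ) r') × PV Γ r' x)) →
    ∀ x → chng (within r run C) x → ¬ (Σ ResName λ r' → InLD (ρ r') × PV Γ' r' x)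
  within-no-chng {ρ = ρ} r-own no-chng x c (r' , ld , pv) with r ≟ r'
  ... | yes refl = ¬InLD-own (subst InLD r-own ld)
  ... | no r≢r' = no-chng x c (r' , subst InLD (sym ([≔]-other ρ r none r' (r≢r' ∘ sym))) ld , pv)

  -- X is protected by the locked r; other locked resources cannot be r, as r ∉ Γ
  agree-inner : ∀ C (s s' : Store) →
    (∀ x → (A x ⊎ Σ ResName λ r' → Locked (within r run C) r' × PV Γ' r' x) → s x ≡ s' x) →
    ∀ x → ((A ∪V X) x ⊎ Σ ResName λ r' → Locked C r' × PV Γ r' x) → s x ≡ s' x
  agree-inner C s s' agree x (inj₁ (inj₁ x∈A)) = agree x (inj₁ x∈A)
  agree-inner C s s' agree x (inj₁ (inj₂ x∈X)) = agree x (inj₂ (r , inj₂ refl , PV-▸-here Γ r X R x x∈X))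
  agree-inner C s s' agree x (inj₂ (r' , locked , pv)) with r ≟ r'
  ... | yes refl = ⊥-elim (PV-fresh Γ r x r∉Γ pv)
  ... | no r≢r' = agree x (inj₂ (r' , inj₁ locked , PV-▸-there Γ r X R r' x r≢r' pv))

  env-inner : ∀ C (s s' : Store) {ĥ ρ ĥ' ρ'} → ρ r ≡ own →
              EnvStep A Γ' (within r run C) s ĥ ρ s' ĥ' ρ' →
              ρ' r ≡ own × EnvStep (A ∪V X) Γ C s ĥ (ρ [ r ≔ none ]ρ) s' ĥ' (ρ' [ r ≔ none ]ρ)
  env-inner C s s' r-own (h , hG , hG' , j , j' , agree , own⇔ , ld⇔ , sat , sat') =
    ρ'-own ,
    (h , hG , hG' , j , j' , agree-inner C s s' agree ,
     [≔]-resp-⇔ (_≡ own) r none own⇔ , [≔]-resp-⇔ InLD r none ld⇔ ,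
     subst (s , hG ⊨_) (⊛Γ'-own-[r≔none] r-own) sat ,
     subst (s' , hG' ⊨_) (⊛Γ'-own-[r≔none] ρ'-own) sat')
    where
    ρ'-own = proj₁ (own⇔ r) r-own

  within-release : ∀ n s h ρ hG ĥ → ρ r ≡ own → s , h ⊨ (Q ∗ R) → Join h hG ĥ →
                   s , hG ⊨ ⊛ Γ' ρ → SafeSplit n Γ' Q A skip s ĥ (ρ [ r ≔ avl ]ρ)
  within-release n s h ρ hG ĥ r-own (h₁ , h₂ , j₁₂ , q , inv-R) j sat =
    h₁ , ĥ ∖ₕ h₁ , proj₁ reassoc ,
    subst (s , ĥ ∖ₕ h₁ ⊨_) (sym (⊛Γ'-avl ρ))
      (hG , h₂ , proj₂ reassoc , subst (s , hG ⊨_) (⊛Γ'-own r-own) sat , inv-R) ,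
    Safe-skip n Γ' (ρ [ r ≔ avl ]ρ) s h₁ Q A Γ'-ok FVQ⊆A q
    where
    reassoc = Join-reassoc {h₁} {h₂} {h} {hG} {ĥ} j₁₂ j

  mutual
    within-safe : ∀ n C s h ρ → ρ r ≡ own →
                  Safe n C s h (ρ [ r ≔ none ]ρ) Γ (Q ∗ R) (A ∪V X) →
                  Safe n (within r run C) s h ρ Γ' Q A
    within-safe zero C s h ρ r-own safe = tt
    within-safe (suc n) C s h ρ r-own safe@(_ , ¬abort , no-chng , _) =
      (λ ()) , within-¬abort r-own ¬abort , within-no-chng {C = C} r-own no-chng ,
      within-continue n C s h ρ r-own safe

    within-continue : ∀ n C s h ρ → ρ r ≡ own →
      Safe (suc n) C s h (ρ [ r ≔ none ]ρ) Γ (Q ∗ R) (A ∪V X) →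
      ∀ hG ĥ → Join h hG ĥ → s , hG ⊨ ⊛ Γ' ρ →
      ∀ C' s' ĥ' ρ' → AStep A Γ' (within r run C) s ĥ ρ C' s' ĥ' ρ' → SafeSplit n Γ' Q A C' s' ĥ' ρ'
    within-continue n C s h ρ r-own safe hG ĥ j sat _ _ _ _ (prog (W1 _ st)) =
      within-body-step n {h = h} {hG = hG} r-own safe j sat st
    within-continue n .skip s h ρ r-own (final , _) hG ĥ j sat _ _ _ _ (prog (W2 _)) =
      within-release n s h ρ hG ĥ r-own (final refl) j sat
    within-continue n C s h ρ r-own (_ , _ , _ , continue) hG ĥ j sat _ s' ĥ' ρ' (env es)
      with env-inner C s s' {ĥ} {ρ} {ĥ'} {ρ'} r-own es
    ... | ρ'-own , es'
      with continue hG ĥ j (subst (s , hG ⊨_) (⊛Γ'-own-[r≔none] r-own) sat) C s' ĥ' (ρ' [ r ≔ none ]ρ) (env es')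
    ... | h' , hG' , j' , sat' , safe' =
      h' , hG' , j' , subst (s' , hG' ⊨_) (sym (⊛Γ'-own-[r≔none] ρ'-own)) sat' ,
      within-safe n C s' h' ρ' ρ'-own safe'

    within-body-step : ∀ n {C C' s h ρ s' ĥ ĥ' ρ₁ hG} → ρ r ≡ own →
      Safe (suc n) C s h (ρ [ r ≔ none ]ρ) Γ (Q ∗ R) (A ∪V X) →
      Join h hG ĥ → s , hG ⊨ ⊛ Γ' ρ →
      Step C s ĥ (ρ [ r ≔ none ]ρ) C' s' ĥ' ρ₁ →
      SafeSplit n Γ' Q A (within r run C') s' ĥ' (ρ₁ [ r ≔ own ]ρ)
    within-body-step n {C' = C'} {s = s} {ρ = ρ} {s' = s'} {ρ₁ = ρ₁} {hG = hG}
                     r-own (_ , _ , _ , continue) j sat st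
      with continue _ _ j (subst (s , hG ⊨_) (⊛Γ'-own-[r≔none] r-own) sat) C' s' _ ρ₁ (prog st)
    ... | h' , hG' , j' , sat' , safe' =
      h' , hG' , j' ,
      subst (s' , hG' ⊨_) (sym (trans (⊛Γ'-own ([≔]-same ρ₁ r own)) (⊛Γ-[r≔] ρ₁ own))) sat' ,
      within-safe n C' s' h' (ρ₁ [ r ≔ own ]ρ) ([≔]-same ρ₁ r own)
        (Safe-resp-≐ n (≐-sym ([≔]-undo ρ₁ r own ρ₁-none)) safe')
      where
      ρ₁-none : ρ₁ r ≡ none
      ρ₁-none = Step-preserves-none r st ([≔]-same ρ r none)

proposition14 : (n : ℕ) (C : Cmd) (s : Store) (h : Heap) (Γ : RCtx) (ρ : RConf)
                (Q R : Assn) (A X : VarSet) (r : ResName) →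
                Reachable C →
                ρ r ≡ own →
                IsResCtx (Γ ▸ entry r X R) →
                FV Q ⊆V A →
                Safe n C s h (ρ [ r ≔ none ]ρ) Γ (Q ∗ R) (A ∪V X) →
                Safe n (within r run C) s h ρ (Γ ▸ entry r X R) Q A
proposition14 n C s h Γ ρ Q R A X r _ r-own Γ'-ok FVQ⊆A =
  WithinRule.within-safe Γ Q R A X r Γ'-ok FVQ⊆A n C s h ρ r-own
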